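{- Let $n$ be a positive integer and let $G$ be a graph such that $\mathrm{bw}(G) \geq 25n-1$. Then $\mathrm{mimw}(L(G)) \geq n$.
   Context: All graphs are finite and simple. $L(G)$ is the line graph of $G$. For a set $S$ and symmetric $f:2^S\to\mathbb{Z}$ (i.e. $f(X)=f(S\setminus X)$), a branch decomposition on $S$ is a pair $(T,\delta)$ with $T$ a tree of maximum degree at most $3$ and $\delta$ a bijection from $S$ to the leaves of $T$; each edge $e$ induces a bipartition $(A_e,\overline{A_e})$ of $S$. The $f$-branch-width on $S$ is the minimum over branch decompositions of $\max_e f(A_e)$ if $|S|\ge 2$, and $f(\emptyset)$ otherwise. Branch-width: for $X\subseteq E(G)$, $\mathrm{mid}(X)$ is the set of vertices incident with both an edge in $X$ and an edge in $E(G)\setminus X$; $\mathrm{bw}(G)$ is the $|\mathrm{mid}(\cdot)|$-branch-width on $E(G)$. Mim-width: for $X\subseteq V(H)$, $\mathrm{cutmim}_H(X)$ is the maximum size of an induced matching of the bipartite graph of edges of $H$ between $X$ and $V(H)\setminus X$; $\mathrm{mimw}(H)$ is the $\mathrm{cutmim}_H$-branch-width on $V(H)$. -}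

module Defs where

open import Data.Nat using (ℕ; zero; suc; _≤_; _⊔_; _<_; _≡ᵇ_)
open import Data.Bool using (Bool; true; false; _∧_; _∨_; not; _xor_; if_then_else_)
open import Data.Bool.Properties using (∧-comm)
open import Data.Fin using (Fin; zero; suc; _≟_)
open import Data.List using (List; []; _∷_; map; foldr; concatMap)
open import Data.Product using (Σ; ∃; ∃-syntax; _×_; _,_; proj₁; proj₂)
open import Data.Sum using (_⊎_)
open import Data.Empty using (⊥-elim)
open import Relation.Nullary using (¬_; yes; no; does)
open import Relation.Binary.PropositionalEquality using (_≡_; refl; cong; cong₂)
open import Function.Bundles using (_⇔_)
import Data.Vec.Functional as VF

anyFin : {n : ℕ} → (Fin n → Bool) → Bool
anyFin {zero}  f = false
anyFin {suc n} f = f zero ∨ anyFin (λ i → f (suc i))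

allFin : {n : ℕ} → (Fin n → Bool) → Bool
allFin {zero}  f = true
allFin {suc n} f = f zero ∧ allFin (λ i → f (suc i))

countFin : {n : ℕ} → (Fin n → Bool) → ℕ
countFin {zero}  f = 0
countFin {suc n} f = (if f zero then 1 else 0) Data.Nat.+ countFin (λ i → f (suc i))

anyFin-cong : {n : ℕ} {f g : Fin n → Bool} → (∀ i → f i ≡ g i) → anyFin f ≡ anyFin g
anyFin-cong {zero}  h = refl
anyFin-cong {suc n} h = cong₂ _∨_ (h zero) (anyFin-cong (λ i → h (suc i)))

Subset : ℕ → Set
Subset n = Fin n → Bool

allSubsets : (n : ℕ) → List (Subset n)
allSubsets zero    = (λ ()) ∷ []
allSubsets (suc n) = concatMap (λ P → (true VF.∷ P) ∷ (false VF.∷ P) ∷ []) (allSubsets n)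

maxList : List ℕ → ℕ
maxList = foldr _⊔_ 0

eqb : {n : ℕ} → Fin n → Fin n → Bool
eqb i j = does (i ≟ j)

eqb-sym : {n : ℕ} (i j : Fin n) → eqb i j ≡ eqb j i
eqb-sym i j with i ≟ j | j ≟ i
... | yes _ | yes _ = refl
... | yes p | no q  = ⊥-elim (q (Relation.Binary.PropositionalEquality.sym p))
... | no p  | yes q = ⊥-elim (p (Relation.Binary.PropositionalEquality.sym q))
... | no _  | no _  = refl

eqb-refl : {n : ℕ} (i : Fin n) → eqb i i ≡ true
eqb-refl i with i ≟ i
... | yes _ = refl
... | no p  = ⊥-elim (p refl)

record Graph : Set where
  field
    n     : ℕ
    Adj   : Fin n → Fin n → Bool
    sym   : ∀ x y → Adj x y ≡ Adj y x
    irrefl : ∀ x → Adj x x ≡ false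

degree : (H : Graph) → Fin (Graph.n H) → ℕ
degree H x = countFin (Graph.Adj H x)

-- Finite simple graphs G presented with an explicit edge set E(G) = Fin nE.  Every finite simple graph has
-- such a presentation.

record SimpleGraph : Set where
  field
    nV   : ℕ
    nE   : ℕ
    ends : Fin nE → Fin nV × Fin nV
    loopless : ∀ e → ¬ (proj₁ (ends e) ≡ proj₂ (ends e))
    noParallel : ∀ e f →
      ((proj₁ (ends e) ≡ proj₁ (ends f)) × (proj₂ (ends e) ≡ proj₂ (ends f))) ⊎
      ((proj₁ (ends e) ≡ proj₂ (ends f)) × (proj₂ (ends e) ≡ proj₁ (ends f))) →
      e ≡ f

incident : (G : SimpleGraph) → Fin (SimpleGraph.nV G) → Fin (SimpleGraph.nE G) → Bool
incident G v e = eqb (proj₁ (SimpleGraph.ends G e)) v ∨ eqb (proj₂ (SimpleGraph.ends G e)) v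

lineAdj : (G : SimpleGraph) → Fin (SimpleGraph.nE G) → Fin (SimpleGraph.nE G) → Bool
lineAdj G e f = not (eqb e f) ∧ anyFin (λ v → incident G v e ∧ incident G v f)

lineGraph : SimpleGraph → Graph
lineGraph G = record
  { n      = SimpleGraph.nE G
  ; Adj    = lineAdj G
  ; sym    = λ e f → cong₂ _∧_ (cong not (eqb-sym e f))
                       (anyFin-cong (λ v → ∧-comm (incident G v e) (incident G v f)))
  ; irrefl = λ e → cong (λ b → not b ∧ anyFin (λ v → incident G v e ∧ incident G v e)) (eqb-refl e)
  }

data Reach {t : ℕ} (R : Fin t → Fin t → Set) : Fin t → Fin t → Set where
  here : ∀ {x} → Reach R x x
  step : ∀ {x z y} → R x z → Reach R z y → Reach R x y

EdgeRel : (T : Graph) → Fin (Graph.n T) → Fin (Graph.n T) → Set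
EdgeRel T x y = Graph.Adj T x y ≡ true

EdgeRelMinus : (T : Graph) → (a b : Fin (Graph.n T)) → Fin (Graph.n T) → Fin (Graph.n T) → Set
EdgeRelMinus T a b x y =
  EdgeRel T x y × ¬ (((x ≡ a) × (y ≡ b)) ⊎ ((x ≡ b) × (y ≡ a)))

-- a tree: connected, and acyclic (every edge is a bridge, i.e. its ends are
-- disconnected after deleting it)
record IsTree (T : Graph) : Set where
  field
    connected : ∀ x y → Reach (EdgeRel T) x y
    acyclic   : ∀ a b → EdgeRel T a b → ¬ Reach (EdgeRelMinus T a b) a b

record BranchDecomposition (k : ℕ) : Set where
  field
    T      : Graph
    isTree : IsTree T
    maxDeg : ∀ x → degree T x ≤ 3
    δ      : Fin k → Fin (Graph.n T)
    δ-inj  : ∀ s s′ → δ s ≡ δ s′ → s ≡ s′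
    δ-leaves : ∀ x → (degree T x ≡ 1) ⇔ (∃[ s ] δ s ≡ x)

module _ {k : ℕ} (D : BranchDecomposition k) where
  open BranchDecomposition D

  IsSide : (a b : Fin (Graph.n T)) → Subset k → Set
  IsSide a b A = ∀ s → (A s ≡ true) ⇔ Reach (EdgeRelMinus T a b) a (δ s)

  WidthAtMost : (Subset k → ℕ) → ℕ → Set
  WidthAtMost f w = ∀ a b → EdgeRel T a b → ∀ A → IsSide a b A → f A ≤ w

  WidthAtLeast : (Subset k → ℕ) → ℕ → Set
  WidthAtLeast f w = ∃[ a ] ∃[ b ] (EdgeRel T a b × ∃[ A ] (IsSide a b A × w ≤ f A))

-- w is the f-branch-width on S = Fin k (for symmetric f):
-- the minimum over branch decompositions of the maximum over tree edges
-- if |S| ≥ 2, and f(∅) otherwise.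
IsFBranchWidth : (k : ℕ) → (Subset k → ℕ) → ℕ → Set
IsFBranchWidth k f w with 2 Data.Nat.≤? k
... | yes _ = (∃[ D ] WidthAtMost D f w) × (∀ D → WidthAtLeast D f w)
... | no _  = w ≡ f (λ _ → false)

midSize : (G : SimpleGraph) → Subset (SimpleGraph.nE G) → ℕ
midSize G X = countFin (λ v →
  anyFin (λ e → X e ∧ incident G v e) ∧ anyFin (λ e → not (X e) ∧ incident G v e))

IsBranchWidth : SimpleGraph → ℕ → Set
IsBranchWidth G w = IsFBranchWidth (SimpleGraph.nE G) (midSize G) w

-- P ⊆ V(H) is the vertex set of an induced matching of the bipartite graph
-- H[X, V(H) ∖ X] iff every vertex of P has exactly one neighbour in P in that
-- bipartite graph; the matching then has |P ∩ X| edges.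
crossAdj : (H : Graph) → Subset (Graph.n H) → Fin (Graph.n H) → Fin (Graph.n H) → Bool
crossAdj H X u v = Graph.Adj H u v ∧ (X u xor X v)

isInducedMatchingSet : (H : Graph) → Subset (Graph.n H) → Subset (Graph.n H) → Bool
isInducedMatchingSet H X P =
  allFin (λ v → not (P v) ∨ (countFin (λ u → P u ∧ crossAdj H X v u) ≡ᵇ 1))

cutmim : (H : Graph) → Subset (Graph.n H) → ℕ
cutmim H X = maxList (map (λ P → if isInducedMatchingSet H X P
                                   then countFin (λ v → P v ∧ X v) else 0)
                          (allSubsets (Graph.n H)))

IsMimWidth : Graph → ℕ → Set
IsMimWidth H w = IsFBranchWidth (Graph.n H) (cutmim H) w

module Submission where

-- Every cut X of E(G) satisfies |mid(X)| ≤ 24 · cutmim_{L(G)}(X), so bw(G) ≤ 24 · mimw(L(G)).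
-- For the inequality, give each v ∈ mid(X) an edge v a(v) in X and an edge v b(v) outside X.
-- A subset S of mid(X) with |mid(X)| ≤ 24|S| on which a(y) ≠ z, b(y) ≠ z and a(y) ≠ b(z) is
-- found by averaging over 2-colourings and then taking an independent set of the functional
-- digraph a; for such S the edges v a(v), v b(v) (v ∈ S) form an induced matching of L(G)
-- across X with |S| edges.

open import Defs
open import Data.Nat using (ℕ; zero; suc; _+_; _*_; _∸_; _^_; _≤_; _<_; z≤n; s≤s; _≤?_; _⊔_; _≡ᵇ_)
open import Data.Nat.Properties hiding (_≟_)
open import Data.Bool using (Bool; true; false; _∧_; _∨_; not; _xor_; if_then_else_; _≟_)
open import Data.Bool.Properties using (∨-zeroʳ; ∧-zeroʳ; ∧-identityʳ; ∨-identityʳ; ∨-comm; ¬-not; not-involutive)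
open import Data.Fin using (Fin; zero; suc)
import Data.Fin.Properties as Fin
open import Data.Maybe using (Maybe; just; nothing; is-just)
open import Data.Product using (∃-syntax; _×_; _,_; proj₁; proj₂)
open import Data.Sum using (_⊎_; inj₁; inj₂)
open import Data.Empty using (⊥-elim)
open import Data.List as List using ([])
open import Data.List.Relation.Unary.Any using (Any; here; there)
import Data.List.Relation.Unary.Any as Any
import Data.List.Relation.Unary.Any.Properties as Any
open import Relation.Nullary using (yes; no)
open import Relation.Nullary.Decidable using (_×-dec_)
open import Relation.Binary.PropositionalEquality
open import Induction.WellFounded using (Acc; acc)
open import Data.Nat.Induction using (<-wellFounded)
open import Data.Vec.Functional using (_∷_)
open import Algebra.Properties.Semiring.Sum +-*-semiring
  using (sum; ∑-comm; ∑-distrib-+; *-distribˡ-sum; sum-cong-≗)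
open import Algebra.Properties.CommutativeSemigroup *-commutativeSemigroup using (x∙yz≈y∙xz)

ind : Bool → ℕ
ind b = if b then 1 else 0

ind-mono : ∀ {x y} → (x ≡ true → y ≡ true) → ind x ≤ ind y
ind-mono {false}         _ = z≤n
ind-mono {true} {true}   _ = ≤-refl
ind-mono {true} {false}  h with () ← h refl

true≢false : true ≢ false
true≢false ()

∧-true⁻ˡ : ∀ {x y} → x ∧ y ≡ true → x ≡ true
∧-true⁻ˡ {true} _ = refl

∧-true⁻ʳ : ∀ {x y} → x ∧ y ≡ true → y ≡ true
∧-true⁻ʳ {true} p = p

∧-true⁺ : ∀ {x y} → x ≡ true → y ≡ true → x ∧ y ≡ true
∧-true⁺ refl refl = refl

∨-true⁻ : ∀ {x y} → x ∨ y ≡ true → x ≡ true ⊎ y ≡ true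
∨-true⁻ {true}  _ = inj₁ refl
∨-true⁻ {false} p = inj₂ p

∨-true⁺ˡ : ∀ {x y} → x ≡ true → x ∨ y ≡ true
∨-true⁺ˡ refl = refl

∨-true⁺ʳ : ∀ {x y} → y ≡ true → x ∨ y ≡ true
∨-true⁺ʳ {x} refl = ∨-zeroʳ x

not-true⁻ : ∀ {x} → not x ≡ true → x ≡ false
not-true⁻ {false} _ = refl

Bool-ext : ∀ {x y} → (x ≡ true → y ≡ true) → (y ≡ true → x ≡ true) → x ≡ y
Bool-ext {true}  {true}  _ _ = refl
Bool-ext {true}  {false} f _ = sym (f refl)
Bool-ext {false} {true}  _ g = g refl
Bool-ext {false} {false} _ _ = refl

eqb⇒≡ : ∀ {n} {x y : Fin n} → eqb x y ≡ true → x ≡ y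
eqb⇒≡ {x = x} {y} p with x Fin.≟ y
... | yes x≡y = x≡y

eqb≡false⇒≢ : ∀ {n} {x y : Fin n} → eqb x y ≡ false → x ≢ y
eqb≡false⇒≢ {x = x} e refl with () ← trans (sym e) (eqb-refl x)

≡⇒eqb : ∀ {n} {x y : Fin n} → x ≡ y → eqb x y ≡ true
≡⇒eqb {x = x} refl = eqb-refl x

≢⇒eqb : ∀ {n} {x y : Fin n} → x ≢ y → eqb x y ≡ false
≢⇒eqb {x = x} {y} x≢y with x Fin.≟ y
... | yes x≡y = ⊥-elim (x≢y x≡y)
... | no _    = refl

anyFin⁻ : ∀ {n} (f : Fin n → Bool) → anyFin f ≡ true → ∃[ i ] f i ≡ true
anyFin⁻ {suc n} f p with f zero in fz
... | true  = zero , fz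
... | false = let i , fi = anyFin⁻ (λ i → f (suc i)) p in suc i , fi

anyFin⁺ : ∀ {n} (f : Fin n → Bool) (i : Fin n) → f i ≡ true → anyFin f ≡ true
anyFin⁺ f zero    fi rewrite fi = refl
anyFin⁺ f (suc i) fi = ∨-true⁺ʳ {f zero} (anyFin⁺ (λ j → f (suc j)) i fi)

allFin⁺ : ∀ {n} (f : Fin n → Bool) → (∀ i → f i ≡ true) → allFin f ≡ true
allFin⁺ {zero}  f _ = refl
allFin⁺ {suc n} f h rewrite h zero = allFin⁺ (λ i → f (suc i)) (λ i → h (suc i))

allFin⁻ : ∀ {n} (f : Fin n → Bool) → allFin f ≡ true → ∀ i → f i ≡ true
allFin⁻ f p zero    = ∧-true⁻ˡ p
allFin⁻ f p (suc i) = allFin⁻ (λ j → f (suc j)) (∧-true⁻ʳ {f zero} p) i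

allFin-cong : ∀ {n} {f g : Fin n → Bool} → f ≗ g → allFin f ≡ allFin g
allFin-cong {zero}  _ = refl
allFin-cong {suc n} h = cong₂ _∧_ (h zero) (allFin-cong (λ i → h (suc i)))

sum-mono : ∀ {n} {f g : Fin n → ℕ} → (∀ i → f i ≤ g i) → sum f ≤ sum g
sum-mono {zero}  _ = z≤n
sum-mono {suc n} h = +-mono-≤ (h zero) (sum-mono (λ i → h (suc i)))

countFin-sum : ∀ {n} (f : Fin n → Bool) → countFin f ≡ sum (λ i → ind (f i))
countFin-sum {zero}  _ = refl
countFin-sum {suc n} f = cong (ind (f zero) +_) (countFin-sum (λ i → f (suc i)))

countFin-cong : ∀ {n} {f g : Fin n → Bool} → f ≗ g → countFin f ≡ countFin g
countFin-cong {zero}  _ = refl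
countFin-cong {suc n} h = cong₂ _+_ (cong ind (h zero)) (countFin-cong (λ i → h (suc i)))

countFin-const-false : ∀ {n} (f : Fin n → Bool) → (∀ i → f i ≡ false) → countFin f ≡ 0
countFin-const-false {zero}  _ _ = refl
countFin-const-false {suc n} f h rewrite h zero = countFin-const-false (λ i → f (suc i)) (λ i → h (suc i))

countFin-eqb : ∀ {n} (c : Fin n) → countFin (eqb c) ≡ 1
countFin-eqb {suc n} zero    = cong suc (countFin-const-false {n} (λ i → eqb zero (suc i)) (λ _ → refl))
countFin-eqb {suc n} (suc c) = countFin-eqb c

countFin-mono : ∀ {n} (f g : Fin n → Bool) → (∀ i → f i ≡ true → g i ≡ true) → countFin f ≤ countFin g
countFin-mono {zero}  _ _ _ = z≤n
countFin-mono {suc n} f g h with f zero in fz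
... | true  rewrite h zero fz = s≤s (countFin-mono _ _ (λ i → h (suc i)))
... | false = ≤-trans (countFin-mono _ _ (λ i → h (suc i))) (m≤n+m _ (ind (g zero)))

countFin-∨ : ∀ {n} (f g : Fin n → Bool) → countFin (λ i → f i ∨ g i) ≤ countFin f + countFin g
countFin-∨ f g = begin
  countFin (λ i → f i ∨ g i)            ≡⟨ countFin-sum (λ i → f i ∨ g i) ⟩
  sum (λ i → ind (f i ∨ g i))           ≤⟨ sum-mono (λ i → ind-∨ (f i) (g i)) ⟩
  sum (λ i → ind (f i) + ind (g i))     ≡⟨ ∑-distrib-+ (λ i → ind (f i)) (λ i → ind (g i)) ⟩
  sum (λ i → ind (f i)) + sum (λ i → ind (g i)) ≡⟨ sym (cong₂ _+_ (countFin-sum f) (countFin-sum g)) ⟩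
  countFin f + countFin g               ∎
  where
  open ≤-Reasoning
  ind-∨ : ∀ x y → ind (x ∨ y) ≤ ind x + ind y
  ind-∨ true  _     = s≤s z≤n
  ind-∨ false _     = ≤-refl

countFin-remove : ∀ {n} (f : Fin n → Bool) (c : Fin n) → f c ≡ true →
  countFin f ≡ suc (countFin (λ i → f i ∧ not (eqb i c)))
countFin-remove {suc n} f zero fc rewrite fc =
  cong suc (countFin-cong (λ i → sym (∧-identityʳ (f (suc i)))))
countFin-remove {suc n} f (suc c) fc with f zero
... | true  = cong suc (countFin-remove (λ i → f (suc i)) c fc)
... | false = countFin-remove (λ i → f (suc i)) c fc

countFin-insert : ∀ {n} (f : Fin n → Bool) (c : Fin n) → f c ≡ false →
  countFin (λ i → f i ∨ eqb i c) ≡ suc (countFin f)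
countFin-insert f c fc =
  trans (countFin-remove _ c (∨-true⁺ʳ {f c} (eqb-refl c))) (cong suc (countFin-cong away))
  where
  away : ∀ i → ((f i ∨ eqb i c) ∧ not (eqb i c)) ≡ f i
  away i with eqb i c in e
  ... | true  = trans (∧-zeroʳ _) (sym (subst (λ j → f j ≡ false) (sym (eqb⇒≡ e)) fc))
  ... | false = trans (∧-identityʳ _) (∨-identityʳ _)

countFin-pos : ∀ {n} (f : Fin n → Bool) (i : Fin n) → f i ≡ true → 1 ≤ countFin f
countFin-pos f i fi rewrite countFin-remove f i fi = s≤s z≤n

countFin-inj : ∀ {n m} (f : Fin n → Bool) (g : Fin m → Bool) (h : ∀ i → f i ≡ true → Fin m) →
  (∀ i p → g (h i p) ≡ true) → (∀ i j p q → h i p ≡ h j q → i ≡ j) → countFin f ≤ countFin g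
countFin-inj {zero}  _ _ _ _ _ = z≤n
countFin-inj {suc n} f g h into inj with f zero in fz
... | false = countFin-inj (λ i → f (suc i)) g (λ i → h (suc i)) (λ i → into (suc i))
                (λ i j p q e → Fin.suc-injective (inj (suc i) (suc j) p q e))
... | true rewrite countFin-remove g (h zero fz) (into zero fz) =
  s≤s (countFin-inj (λ i → f (suc i)) (λ y → g y ∧ not (eqb y (h zero fz))) (λ i → h (suc i))
        (λ i p → ∧-true⁺ (into (suc i) p) (cong not (≢⇒eqb (λ e → Fin.0≢1+n (sym (inj (suc i) zero p fz e))))))
        (λ i j p q e → Fin.suc-injective (inj (suc i) (suc j) p q e)))

∑ₛ : ∀ {N} → (Subset N → ℕ) → ℕ
∑ₛ {zero}  g = g (λ ())
∑ₛ {suc N} g = ∑ₛ (λ P → g (true ∷ P) + g (false ∷ P))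

∑ₛ-cong : ∀ {N} {g h : Subset N → ℕ} → (∀ P → g P ≡ h P) → ∑ₛ g ≡ ∑ₛ h
∑ₛ-cong {zero}  e = e _
∑ₛ-cong {suc N} e = ∑ₛ-cong (λ P → cong₂ _+_ (e (true ∷ P)) (e (false ∷ P)))

∑ₛ-mono : ∀ {N} {g h : Subset N → ℕ} → (∀ P → g P ≤ h P) → ∑ₛ g ≤ ∑ₛ h
∑ₛ-mono {zero}  e = e _
∑ₛ-mono {suc N} e = ∑ₛ-mono (λ P → +-mono-≤ (e (true ∷ P)) (e (false ∷ P)))

∑ₛ-* : ∀ {N} k (g : Subset N → ℕ) → ∑ₛ (λ P → k * g P) ≡ k * ∑ₛ g
∑ₛ-* {zero}  k g = refl
∑ₛ-* {suc N} k g =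
  trans (∑ₛ-cong (λ P → sym (*-distribˡ-+ k (g (true ∷ P)) (g (false ∷ P)))))
        (∑ₛ-* k (λ P → g (true ∷ P) + g (false ∷ P)))

∑ₛ-sum-comm : ∀ {N n} (h : Subset N → Fin n → ℕ) →
  ∑ₛ (λ P → sum (h P)) ≡ sum (λ v → ∑ₛ (λ P → h P v))
∑ₛ-sum-comm {zero}  h = refl
∑ₛ-sum-comm {suc N} h =
  trans (∑ₛ-cong (λ P → sym (∑-distrib-+ (h (true ∷ P)) (h (false ∷ P)))))
        (∑ₛ-sum-comm (λ P v → h (true ∷ P) v + h (false ∷ P) v))

∑ₛ-≤-max : ∀ {N} (g : Subset N → ℕ) → ∃[ P ] ∑ₛ g ≤ 2 ^ N * g P
∑ₛ-≤-max {zero}  g = (λ ()) , ≤-reflexive (sym (+-identityʳ _))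
∑ₛ-≤-max {suc N} g =
  let P , bound = ∑ₛ-≤-max (λ P → g (true ∷ P) + g (false ∷ P))
      Q , larger = larger-extension P
  in Q , (begin
    ∑ₛ (λ P → g (true ∷ P) + g (false ∷ P)) ≤⟨ bound ⟩
    2 ^ N * (g (true ∷ P) + g (false ∷ P))  ≤⟨ *-monoʳ-≤ (2 ^ N) larger ⟩
    2 ^ N * (2 * g Q)                       ≡⟨ sym (*-assoc (2 ^ N) 2 (g Q)) ⟩
    2 ^ N * 2 * g Q                         ≡⟨ cong (_* g Q) (*-comm (2 ^ N) 2) ⟩
    2 * 2 ^ N * g Q                         ∎)
  where
  open ≤-Reasoning
  m+n≤2*[m⊔n] : ∀ x y → x + y ≤ 2 * (x ⊔ y)
  m+n≤2*[m⊔n] x y = ≤-trans (+-mono-≤ (m≤m⊔n x y) (m≤n⊔m x y)) (≤-reflexive (cong ((x ⊔ y) +_) (sym (+-identityʳ _))))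
  larger-extension : (P : Subset N) → ∃[ Q ] g (true ∷ P) + g (false ∷ P) ≤ 2 * g Q
  larger-extension P with ⊔-sel (g (true ∷ P)) (g (false ∷ P)) | m+n≤2*[m⊔n] (g (true ∷ P)) (g (false ∷ P))
  ... | inj₁ e | sum≤2max = true ∷ P ,  ≤-trans sum≤2max (≤-reflexive (cong (2 *_) e))
  ... | inj₂ e | sum≤2max = false ∷ P , ≤-trans sum≤2max (≤-reflexive (cong (2 *_) e))

Pattern : ℕ → Set
Pattern N = Fin N → Maybe Bool

fits : Maybe Bool → Bool → Bool
fits nothing      _ = true
fits (just true)  x = x
fits (just false) x = not x

Matches : ∀ {N} → Pattern N → Subset N → Bool
Matches ρ P = allFin (λ v → fits (ρ v) (P v))

prescribed : ∀ {N} → Pattern N → ℕ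
prescribed ρ = countFin (λ v → is-just (ρ v))

2^prescribed*#matching≡2^N : ∀ {N} (ρ : Pattern N) →
  2 ^ prescribed ρ * ∑ₛ (λ P → ind (Matches ρ P)) ≡ 2 ^ N
2^prescribed*#matching≡2^N {zero}  ρ = refl
2^prescribed*#matching≡2^N {suc N} ρ with ρ zero
... | nothing = begin
  2 ^ p * ∑ₛ (λ P → ind (M P) + ind (M P)) ≡⟨ cong (2 ^ p *_) (∑ₛ-cong (λ P → cong (ind (M P) +_) (sym (+-identityʳ _)))) ⟩
  2 ^ p * ∑ₛ (λ P → 2 * ind (M P))        ≡⟨ cong (2 ^ p *_) (∑ₛ-* 2 (λ P → ind (M P))) ⟩
  2 ^ p * (2 * ∑ₛ (λ P → ind (M P)))      ≡⟨ x∙yz≈y∙xz (2 ^ p) 2 _ ⟩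
  2 * (2 ^ p * ∑ₛ (λ P → ind (M P)))      ≡⟨ cong (2 *_) (2^prescribed*#matching≡2^N ρ′) ⟩
  2 * 2 ^ N                               ∎
  where
  open ≡-Reasoning
  ρ′ = λ v → ρ (suc v)
  p = prescribed ρ′
  M = Matches ρ′
... | just b = begin
  2 * 2 ^ p * ∑ₛ (λ P → ind (fits (just b) true ∧ M P) + ind (fits (just b) false ∧ M P))
    ≡⟨ cong (2 * 2 ^ p *_) (∑ₛ-cong (λ P → one-extension-fits b (M P))) ⟩
  2 * 2 ^ p * ∑ₛ (λ P → ind (M P))   ≡⟨ *-assoc 2 (2 ^ p) _ ⟩
  2 * (2 ^ p * ∑ₛ (λ P → ind (M P))) ≡⟨ cong (2 *_) (2^prescribed*#matching≡2^N ρ′) ⟩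
  2 * 2 ^ N                           ∎
  where
  open ≡-Reasoning
  ρ′ = λ v → ρ (suc v)
  p = prescribed ρ′
  M = Matches ρ′
  one-extension-fits : ∀ b x → ind (fits (just b) true ∧ x) + ind (fits (just b) false ∧ x) ≡ ind x
  one-extension-fits true  x = +-identityʳ _
  one-extension-fits false x = refl

#subsets-x∧y∧¬z : ∀ {N} (x y z : Fin N) → x ≢ y → x ≢ z → y ≢ z →
  2 ^ N ≤ 8 * ∑ₛ (λ P → ind (P x ∧ P y ∧ not (P z)))
#subsets-x∧y∧¬z {N} x y z x≢y x≢z y≢z = begin
  2 ^ N                                              ≡⟨ sym (2^prescribed*#matching≡2^N ρ) ⟩
  2 ^ prescribed ρ * ∑ₛ (λ P → ind (Matches ρ P))    ≤⟨ *-monoˡ-≤ _ (^-monoʳ-≤ 2 prescribed≤3) ⟩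
  8 * ∑ₛ (λ P → ind (Matches ρ P))                   ≤⟨ *-monoʳ-≤ 8 (∑ₛ-mono (λ P → ind-mono (matching⇒x∧y∧¬z P))) ⟩
  8 * ∑ₛ (λ P → ind (P x ∧ P y ∧ not (P z)))         ∎
  where
  open ≤-Reasoning
  ρ : Pattern N
  ρ v = if eqb x v then just true else if eqb y v then just true else if eqb z v then just false else nothing
  prescribed-at : ∀ v → is-just (ρ v) ≡ true → (eqb x v ∨ eqb y v ∨ eqb z v) ≡ true
  prescribed-at v p with eqb x v | eqb y v | eqb z v
  ... | true  | _     | _     = refl
  ... | false | true  | _     = refl
  ... | false | false | true  = refl
  prescribed≤3 : prescribed ρ ≤ 3
  prescribed≤3 = begin
    prescribed ρ                                         ≤⟨ countFin-mono _ _ prescribed-at ⟩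
    countFin (λ v → eqb x v ∨ eqb y v ∨ eqb z v)         ≤⟨ countFin-∨ (eqb x) _ ⟩
    countFin (eqb x) + countFin (λ v → eqb y v ∨ eqb z v) ≤⟨ +-monoʳ-≤ (countFin (eqb x)) (countFin-∨ (eqb y) (eqb z)) ⟩
    countFin (eqb x) + (countFin (eqb y) + countFin (eqb z)) ≡⟨ cong₂ _+_ (countFin-eqb x) (cong₂ _+_ (countFin-eqb y) (countFin-eqb z)) ⟩
    3                                                    ∎
  ρx : ρ x ≡ just true
  ρx rewrite eqb-refl x = refl
  ρy : ρ y ≡ just true
  ρy rewrite ≢⇒eqb x≢y | eqb-refl y = refl
  ρz : ρ z ≡ just false
  ρz rewrite ≢⇒eqb x≢z | ≢⇒eqb y≢z | eqb-refl z = refl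
  matching⇒x∧y∧¬z : ∀ P → Matches ρ P ≡ true → (P x ∧ P y ∧ not (P z)) ≡ true
  matching⇒x∧y∧¬z P m = ∧-true⁺ (fits-at x ρx) (∧-true⁺ (fits-at y ρy) (fits-at z ρz))
    where
    fits-at : ∀ v {r} → ρ v ≡ r → fits r (P v) ≡ true
    fits-at v refl = allFin⁻ _ m v

-- ∑ₛ sums over 2 ^ N subsets: each v ∈ M lies in F P with probability at least 1/k.
averaging : ∀ {N n} (M : Subset n) (F : Subset N → Subset n) (k : ℕ) →
  (∀ v → M v ≡ true → 2 ^ N ≤ k * ∑ₛ (λ P → ind (F P v))) →
  ∃[ P ] countFin M ≤ k * countFin (F P)
averaging {N} M F k often = P , *-cancelˡ-≤ (2 ^ N) {{m^n≢0 2 N}} (begin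
  2 ^ N * countFin M                                 ≡⟨ cong (2 ^ N *_) (countFin-sum M) ⟩
  2 ^ N * sum (λ v → ind (M v))                      ≡⟨ *-distribˡ-sum (2 ^ N) (λ v → ind (M v)) ⟩
  sum (λ v → 2 ^ N * ind (M v))                      ≤⟨ sum-mono pointwise ⟩
  sum (λ v → k * ∑ₛ (λ P → ind (F P v)))             ≡⟨ sym (*-distribˡ-sum k (λ v → ∑ₛ (λ P → ind (F P v)))) ⟩
  k * sum (λ v → ∑ₛ (λ P → ind (F P v)))             ≡⟨ cong (k *_) (sym (∑ₛ-sum-comm (λ P v → ind (F P v)))) ⟩
  k * ∑ₛ (λ P → sum (λ v → ind (F P v)))             ≡⟨ cong (k *_) (∑ₛ-cong (λ P → sym (countFin-sum (F P)))) ⟩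
  k * ∑ₛ (λ P → countFin (F P))                      ≤⟨ *-monoʳ-≤ k bound ⟩
  k * (2 ^ N * countFin (F P))                       ≡⟨ x∙yz≈y∙xz k (2 ^ N) _ ⟩
  2 ^ N * (k * countFin (F P))                       ∎)
  where
  open ≤-Reasoning
  P = proj₁ (∑ₛ-≤-max (λ P → countFin (F P)))
  bound = proj₂ (∑ₛ-≤-max (λ P → countFin (F P)))
  pointwise : ∀ v → 2 ^ N * ind (M v) ≤ k * ∑ₛ (λ P → ind (F P v))
  pointwise v with M v in Mv
  ... | true  = ≤-trans (≤-reflexive (*-identityʳ _)) (often v Mv)
  ... | false = ≤-trans (≤-reflexive (*-zeroʳ (2 ^ N))) z≤n

_⊆_ : ∀ {n} → Subset n → Subset n → Set
S ⊆ T = ∀ v → S v ≡ true → T v ≡ true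

module FunctionalDigraph {N : ℕ} (a : Fin N → Fin N) where

  Independent : Subset N → Set
  Independent S = ∀ v w → S v ≡ true → S w ≡ true → a v ≢ w

  inDegree : Subset N → Fin N → ℕ
  inDegree T u = countFin (λ v → T v ∧ eqb (a v) u)

  ∑-inDegree : ∀ T → sum (inDegree T) ≡ countFin T
  ∑-inDegree T = begin
    sum (λ u → countFin (λ v → T v ∧ eqb (a v) u))          ≡⟨ sum-cong-≗ (λ u → countFin-sum (λ v → T v ∧ eqb (a v) u)) ⟩
    sum (λ u → sum (λ v → ind (T v ∧ eqb (a v) u)))         ≡⟨ ∑-comm (λ u v → ind (T v ∧ eqb (a v) u)) ⟩
    sum (λ v → sum (λ u → ind (T v ∧ eqb (a v) u)))         ≡⟨ sum-cong-≗ (λ v → sym (countFin-sum (λ u → T v ∧ eqb (a v) u))) ⟩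
    sum (λ v → countFin (λ u → T v ∧ eqb (a v) u))          ≡⟨ sum-cong-≗ one-successor ⟩
    sum (λ v → ind (T v))                                   ≡⟨ sym (countFin-sum T) ⟩
    countFin T                                              ∎
    where
    open ≡-Reasoning
    one-successor : ∀ v → countFin (λ u → T v ∧ eqb (a v) u) ≡ ind (T v)
    one-successor v with T v
    ... | true  = countFin-eqb (a v)
    ... | false = countFin-const-false {N} (λ _ → false) (λ _ → refl)

  -- The in-degrees sum to |T|, so they cannot all be at least 2 on T.
  low-inDegree : ∀ T u₀ → T u₀ ≡ true → ∃[ u ] T u ≡ true × inDegree T u ≤ 1
  low-inDegree T u₀ Tu₀ with Fin.any? (λ u → (T u ≟ true) ×-dec (inDegree T u ≤? 1))
  ... | yes found = found
  ... | no none   = ⊥-elim (<⇒≱ (countFin-pos T u₀ Tu₀) (+-cancelˡ-≤ (countFin T) (countFin T) 0 double≤single))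
    where
    open ≤-Reasoning
    high : ∀ u → 2 * ind (T u) ≤ inDegree T u
    high u with T u in Tu
    ... | false = z≤n
    ... | true  = ≰⇒> (λ low → none (u , Tu , low))
    double≤single : countFin T + countFin T ≤ countFin T + 0
    double≤single = begin
      countFin T + countFin T      ≡⟨ cong (countFin T +_) (sym (+-identityʳ _)) ⟩
      2 * countFin T               ≡⟨ cong (2 *_) (countFin-sum T) ⟩
      2 * sum (λ u → ind (T u))    ≡⟨ *-distribˡ-sum 2 (λ u → ind (T u)) ⟩
      sum (λ u → 2 * ind (T u))    ≤⟨ sum-mono high ⟩
      sum (inDegree T)             ≡⟨ ∑-inDegree T ⟩
      countFin T                   ≡⟨ sym (+-identityʳ _) ⟩
      countFin T + 0               ∎

  module Removal (T : Subset N) (u : Fin N) where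

    T⁻ : Subset N
    T⁻ v = T v ∧ not (eqb v u) ∧ not (eqb v (a u)) ∧ not (eqb (a v) u)

    T⁻-spec : ∀ {v} → T⁻ v ≡ true → T v ≡ true × v ≢ u × v ≢ a u × a v ≢ u
    T⁻-spec {v} p with T v | eqb v u in e₁ | eqb v (a u) in e₂ | eqb (a v) u in e₃
    ... | true | false | false | false = refl , eqb≡false⇒≢ e₁ , eqb≡false⇒≢ e₂ , eqb≡false⇒≢ e₃

    |T⁻|<|T| : T u ≡ true → countFin T⁻ < countFin T
    |T⁻|<|T| Tu = begin-strict
      countFin T⁻                               ≤⟨ countFin-mono T⁻ _ (λ v p → ∧-true⁺ (proj₁ (T⁻-spec p))
                                                     (cong not (≢⇒eqb (proj₁ (proj₂ (T⁻-spec p)))))) ⟩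
      countFin (λ v → T v ∧ not (eqb v u))      <⟨ ≤-reflexive (sym (countFin-remove T u Tu)) ⟩
      countFin T                                ∎
      where open ≤-Reasoning

    -- T ⊆ T⁻ ∪ {u} ∪ {a u} ∪ (in-neighbours of u in T)
    |T|≤|T⁻|+3 : inDegree T u ≤ 1 → countFin T ≤ countFin T⁻ + 3
    |T|≤|T⁻|+3 low = begin
      countFin T                                                           ≤⟨ countFin-mono T _ cover ⟩
      countFin (λ v → T⁻ v ∨ eqb u v ∨ eqb (a u) v ∨ (T v ∧ eqb (a v) u))  ≤⟨ countFin-∨ T⁻ _ ⟩
      countFin T⁻ + countFin (λ v → eqb u v ∨ eqb (a u) v ∨ (T v ∧ eqb (a v) u))
        ≤⟨ +-monoʳ-≤ (countFin T⁻) (countFin-∨ (eqb u) _) ⟩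
      countFin T⁻ + (countFin (eqb u) + countFin (λ v → eqb (a u) v ∨ (T v ∧ eqb (a v) u)))
        ≤⟨ +-monoʳ-≤ (countFin T⁻) (+-monoʳ-≤ (countFin (eqb u)) (countFin-∨ (eqb (a u)) _)) ⟩
      countFin T⁻ + (countFin (eqb u) + (countFin (eqb (a u)) + inDegree T u))
        ≤⟨ +-monoʳ-≤ (countFin T⁻) (+-mono-≤ (≤-reflexive (countFin-eqb u))
                                     (+-mono-≤ (≤-reflexive (countFin-eqb (a u))) low)) ⟩
      countFin T⁻ + 3                                                      ∎
      where
      open ≤-Reasoning
      cover : ∀ v → T v ≡ true → (T⁻ v ∨ eqb u v ∨ eqb (a u) v ∨ (T v ∧ eqb (a v) u)) ≡ true
      cover v Tv rewrite Tv | eqb-sym u v | eqb-sym (a u) v with eqb v u | eqb v (a u) | eqb (a v) u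
      ... | true  | _     | _     = refl
      ... | false | true  | _     = refl
      ... | false | false | true  = refl
      ... | false | false | false = refl

    -- u has no edge into T⁻ and T⁻ has no edge into u.
    insert-independent : (∀ v → T v ≡ true → a v ≢ v) → T u ≡ true → ∀ S → S ⊆ T⁻ → Independent S →
      Independent (λ v → S v ∨ eqb v u)
    insert-independent loopless Tu S S⊆T⁻ indep v w Sv Sw with ∨-true⁻ {S v} Sv | ∨-true⁻ {S w} Sw
    ... | inj₁ v∈S | inj₁ w∈S = indep v w v∈S w∈S
    ... | inj₁ v∈S | inj₂ w≡u = λ av≡w → proj₂ (proj₂ (proj₂ (T⁻-spec (S⊆T⁻ v v∈S)))) (trans av≡w (eqb⇒≡ w≡u))
    ... | inj₂ v≡u | inj₁ w∈S = λ av≡w → proj₁ (proj₂ (proj₂ (T⁻-spec (S⊆T⁻ w w∈S))))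
                                           (sym (trans (cong a (sym (eqb⇒≡ v≡u))) av≡w))
    ... | inj₂ v≡u | inj₂ w≡u = λ av≡w → loopless u Tu
                                           (trans (cong a (sym (eqb⇒≡ v≡u))) (trans av≡w (eqb⇒≡ w≡u)))

    insert-⊆ : T u ≡ true → ∀ S → S ⊆ T⁻ → (λ v → S v ∨ eqb v u) ⊆ T
    insert-⊆ Tu S S⊆T⁻ v p with ∨-true⁻ {S v} p
    ... | inj₁ v∈S = proj₁ (T⁻-spec (S⊆T⁻ v v∈S))
    ... | inj₂ v≡u = subst (λ w → T w ≡ true) (sym (eqb⇒≡ v≡u)) Tu

    insert-size : ∀ S → S ⊆ T⁻ → countFin (λ v → S v ∨ eqb v u) ≡ suc (countFin S)
    insert-size S S⊆T⁻ = countFin-insert S u (¬-not (λ Su → proj₁ (proj₂ (T⁻-spec (S⊆T⁻ u Su))) refl))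

  -- Greedily keep a vertex of in-degree at most 1 and discard at most three vertices.
  large-independent-subset : ∀ T → (∀ v → T v ≡ true → a v ≢ v) →
    ∃[ S ] S ⊆ T × Independent S × countFin T ≤ 3 * countFin S
  large-independent-subset T = go T (<-wellFounded (countFin T))
    where
    go : ∀ T → Acc _<_ (countFin T) → (∀ v → T v ≡ true → a v ≢ v) →
      ∃[ S ] S ⊆ T × Independent S × countFin T ≤ 3 * countFin S
    go T (acc smaller) loopless with Fin.any? (λ v → T v ≟ true)
    ... | no T≡∅ = (λ _ → false) , (λ _ ()) , (λ _ _ ()) ,
        subst (_≤ _) (sym (countFin-const-false T (λ v → ¬-not (λ Tv → T≡∅ (v , Tv))))) z≤n
    ... | yes (u₀ , Tu₀) with low-inDegree T u₀ Tu₀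
    ... | u , Tu , low =
      let S , S⊆T⁻ , indep , |T⁻|≤3|S| = go T⁻ (smaller (|T⁻|<|T| Tu)) (λ v p → loopless v (proj₁ (T⁻-spec p)))
      in (λ v → S v ∨ eqb v u) , insert-⊆ Tu S S⊆T⁻ , insert-independent loopless Tu S S⊆T⁻ indep ,
         (begin
           countFin T                          ≤⟨ |T|≤|T⁻|+3 low ⟩
           countFin T⁻ + 3                     ≤⟨ +-monoˡ-≤ 3 |T⁻|≤3|S| ⟩
           3 * countFin S + 3                  ≡⟨ +-comm (3 * countFin S) 3 ⟩
           3 + 3 * countFin S                  ≡⟨ sym (*-suc 3 (countFin S)) ⟩
           3 * suc (countFin S)                ≡⟨ cong (3 *_) (sym (insert-size S S⊆T⁻)) ⟩
           3 * countFin (λ v → S v ∨ eqb v u)  ∎)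
      where
      open Removal T u
      open ≤-Reasoning

Separated : ∀ {N} (a b : Fin N → Fin N) → Subset N → Set
Separated a b S = ∀ y z → S y ≡ true → S z ≡ true → a y ≢ z × b y ≢ z × a y ≢ b z

-- A random colouring χ keeps each v ∈ M with χ v = χ (a v) = true, χ (b v) = false with
-- probability 1/8, which rules out b y = z and a y = b z; an independent set of the
-- functional digraph a then rules out a y = z.
large-separated-subset : ∀ {N} (M : Subset N) (a b : Fin N → Fin N) →
  (∀ v → M v ≡ true → a v ≢ v × b v ≢ v × a v ≢ b v) →
  ∃[ S ] S ⊆ M × Separated a b S × countFin M ≤ 24 * countFin S
large-separated-subset {N} M a b distinct =
  S , (λ v Sv → proj₁ (kept (S⊆T v Sv))) , separated ,
  (begin
    countFin M           ≤⟨ |M|≤8|T| ⟩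
    8 * countFin T       ≤⟨ *-monoʳ-≤ 8 |T|≤3|S| ⟩
    8 * (3 * countFin S) ≡⟨ sym (*-assoc 8 3 (countFin S)) ⟩
    24 * countFin S      ∎)
  where
  open ≤-Reasoning
  open FunctionalDigraph a using (large-independent-subset)
  kept-by : Subset N → Subset N
  kept-by χ v = M v ∧ χ v ∧ χ (a v) ∧ not (χ (b v))
  often-kept : ∀ v → M v ≡ true → 2 ^ N ≤ 8 * ∑ₛ (λ χ → ind (kept-by χ v))
  often-kept v Mv rewrite Mv =
    let av≢v , bv≢v , av≢bv = distinct v Mv in
    #subsets-x∧y∧¬z v (a v) (b v) (λ e → av≢v (sym e)) (λ e → bv≢v (sym e)) av≢bv
  χ = proj₁ (averaging M kept-by 8 often-kept)
  |M|≤8|T| = proj₂ (averaging M kept-by 8 often-kept)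
  T = kept-by χ
  kept : ∀ {v} → T v ≡ true → M v ≡ true × χ v ≡ true × χ (a v) ≡ true × χ (b v) ≡ false
  kept {v} p = ∧-true⁻ˡ p , ∧-true⁻ˡ p₁ , ∧-true⁻ˡ p₂ , not-true⁻ (∧-true⁻ʳ {χ (a v)} p₂)
    where
    p₁ = ∧-true⁻ʳ {M v} p
    p₂ = ∧-true⁻ʳ {χ v} p₁
  independent = large-independent-subset T (λ v Tv → proj₁ (distinct v (proj₁ (kept Tv))))
  S = proj₁ independent
  S⊆T = proj₁ (proj₂ independent)
  |T|≤3|S| = proj₂ (proj₂ (proj₂ independent))
  separated : Separated a b S
  separated y z Sy Sz =
    proj₁ (proj₂ (proj₂ independent)) y z Sy Sz ,
    (λ by≡z → true≢false (trans (sym χz) (trans (cong χ (sym by≡z)) χby))) ,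
    (λ ay≡bz → true≢false (trans (sym χay) (trans (cong χ ay≡bz) χbz)))
    where
    χz  = proj₁ (proj₂ (kept (S⊆T z Sz)))
    χbz = proj₂ (proj₂ (proj₂ (kept (S⊆T z Sz))))
    χay = proj₁ (proj₂ (proj₂ (kept (S⊆T y Sy))))
    χby = proj₂ (proj₂ (proj₂ (kept (S⊆T y Sy))))

allSubsets-complete : ∀ {n} (P : Subset n) → Any (P ≗_) (allSubsets n)
allSubsets-complete {zero}  P = here (λ ())
allSubsets-complete {suc n} P =
  Any.concat⁺ (Any.map⁺ (Any.map extend (allSubsets-complete (λ i → P (suc i)))))
  where
  extend : ∀ {Q} → (λ i → P (suc i)) ≗ Q → Any (P ≗_) ((true ∷ Q) List.∷ (false ∷ Q) List.∷ [])
  extend {Q} eq with P zero in P₀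
  ... | true  = here λ { zero → P₀ ; (suc i) → eq i }
  ... | false = there (here λ { zero → P₀ ; (suc i) → eq i })

≤-maxList : ∀ {x xs} → Any (x ≤_) xs → x ≤ maxList xs
≤-maxList (here x≤y) = ≤-trans x≤y (m≤m⊔n _ _)
≤-maxList (there p)  = ≤-trans (≤-maxList p) (m≤n⊔m _ _)

cutmim-≥ : ∀ (H : Graph) (X P : Subset (Graph.n H)) → isInducedMatchingSet H X P ≡ true → countFin (λ v → P v ∧ X v) ≤ cutmim H X
cutmim-≥ H X P matching = subst (_≤ cutmim H X) (cong (λ c → if c then countFin (λ v → P v ∧ X v) else 0) matching)
  (≤-maxList (Any.map⁺ (Any.map (λ P≗Q → ≤-reflexive (size-cong P≗Q)) (allSubsets-complete P))))
  where
  size : Subset (Graph.n H) → ℕ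
  size Q = if isInducedMatchingSet H X Q then countFin (λ v → Q v ∧ X v) else 0
  size-cong : ∀ {Q R} → Q ≗ R → size Q ≡ size R
  size-cong Q≗R = cong₂ (λ c d → if c then d else 0)
    (allFin-cong (λ v → cong₂ _∨_ (cong not (Q≗R v))
                          (cong (_≡ᵇ 1) (countFin-cong (λ u → cong (_∧ crossAdj H X v u) (Q≗R u))))))
    (countFin-cong (λ v → cong (_∧ X v) (Q≗R v)))

module _ (G : SimpleGraph) where
  open SimpleGraph G

  private
    end₁ end₂ : Fin nE → Fin nV
    end₁ e = proj₁ (ends e)
    end₂ e = proj₂ (ends e)

  Joins : Fin nE → Fin nV → Fin nV → Set
  Joins e v u = v ≢ u × incident G v e ≡ true × incident G u e ≡ true

  incident⇒end : ∀ {x e} → incident G x e ≡ true → end₁ e ≡ x ⊎ end₂ e ≡ x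
  incident⇒end p with ∨-true⁻ p
  ... | inj₁ q = inj₁ (eqb⇒≡ q)
  ... | inj₂ q = inj₂ (eqb⇒≡ q)

  incident-end₁ : ∀ e → incident G (end₁ e) e ≡ true
  incident-end₁ e = ∨-true⁺ˡ (eqb-refl (end₁ e))

  incident-end₂ : ∀ e → incident G (end₂ e) e ≡ true
  incident-end₂ e = ∨-true⁺ʳ {eqb (end₁ e) (end₂ e)} (eqb-refl (end₂ e))

  joins-ends : ∀ {e v u} → Joins e v u → (end₁ e ≡ v × end₂ e ≡ u) ⊎ (end₁ e ≡ u × end₂ e ≡ v)
  joins-ends (v≢u , v∈e , u∈e) with incident⇒end v∈e | incident⇒end u∈e
  ... | inj₁ p | inj₁ q = ⊥-elim (v≢u (trans (sym p) q))
  ... | inj₁ p | inj₂ q = inj₁ (p , q)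
  ... | inj₂ p | inj₁ q = inj₂ (q , p)
  ... | inj₂ p | inj₂ q = ⊥-elim (v≢u (trans (sym p) q))

  joins-unique : ∀ {e f v u} → Joins e v u → Joins f v u → e ≡ f
  joins-unique e∼ f∼ with joins-ends e∼ | joins-ends f∼
  ... | inj₁ (p , q) | inj₁ (p′ , q′) = noParallel _ _ (inj₁ (trans p (sym p′) , trans q (sym q′)))
  ... | inj₁ (p , q) | inj₂ (p′ , q′) = noParallel _ _ (inj₂ (trans p (sym q′) , trans q (sym p′)))
  ... | inj₂ (p , q) | inj₁ (p′ , q′) = noParallel _ _ (inj₂ (trans p (sym q′) , trans q (sym p′)))
  ... | inj₂ (p , q) | inj₂ (p′ , q′) = noParallel _ _ (inj₁ (trans p (sym p′) , trans q (sym q′)))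

  joins-incident : ∀ {e v u x} → Joins e v u → incident G x e ≡ true → x ≡ v ⊎ x ≡ u
  joins-incident e∼ x∈e with joins-ends e∼ | incident⇒end x∈e
  ... | inj₁ (p , q) | inj₁ r = inj₁ (trans (sym r) p)
  ... | inj₁ (p , q) | inj₂ r = inj₂ (trans (sym r) q)
  ... | inj₂ (p , q) | inj₁ r = inj₂ (trans (sym r) p)
  ... | inj₂ (p , q) | inj₂ r = inj₁ (trans (sym r) q)

  incident⇒joins : ∀ {v e} → incident G v e ≡ true → ∃[ u ] Joins e v u
  incident⇒joins {v} {e} v∈e with incident⇒end v∈e
  ... | inj₁ p = end₂ e , (λ v≡u → loopless e (trans p v≡u)) , v∈e , incident-end₂ e
  ... | inj₂ p = end₁ e , (λ v≡u → loopless e (trans (sym v≡u) (sym p))) , v∈e , incident-end₁ e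

  -- junk value v when no edge of Y is incident with v
  neighbourVia : Subset nE → Fin nV → Fin nV
  neighbourVia Y v with Fin.any? (λ e → (Y e ∧ incident G v e) ≟ true)
  ... | yes (e , p) = proj₁ (incident⇒joins (∧-true⁻ʳ {Y e} p))
  ... | no _        = v

  neighbourVia-spec : ∀ Y v → anyFin (λ e → Y e ∧ incident G v e) ≡ true →
    ∃[ e ] Y e ≡ true × Joins e v (neighbourVia Y v)
  neighbourVia-spec Y v p with Fin.any? (λ e → (Y e ∧ incident G v e) ≟ true)
  ... | yes (e , q) = e , ∧-true⁻ˡ q , proj₂ (incident⇒joins (∧-true⁻ʳ {Y e} q))
  ... | no none     = ⊥-elim (none (anyFin⁻ _ p))

  joinsᵇ : Fin nE → Fin nV → Fin nV → Bool
  joinsᵇ e v u = incident G v e ∧ incident G u e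

  crossAdj⁻ : ∀ {X e u} → crossAdj (lineGraph G) X e u ≡ true →
    (∃[ x ] incident G x e ≡ true × incident G x u ≡ true) × (X e xor X u) ≡ true
  crossAdj⁻ {X} {e} {u} p =
    let x , q = anyFin⁻ (λ x → incident G x e ∧ incident G x u) (∧-true⁻ʳ {not (eqb e u)} (∧-true⁻ˡ p))
    in (x , ∧-true⁻ˡ q , ∧-true⁻ʳ {incident G x e} q) , ∧-true⁻ʳ {lineAdj G e u} p

  crossAdj⁺ : ∀ {X e u x} → e ≢ u → incident G x e ≡ true → incident G x u ≡ true → (X e xor X u) ≡ true →
    crossAdj (lineGraph G) X e u ≡ true
  crossAdj⁺ {x = x} e≢u x∈e x∈u crossing =
    ∧-true⁺ (∧-true⁺ (cong not (≢⇒eqb e≢u)) (anyFin⁺ _ x (∧-true⁺ x∈e x∈u))) crossing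

  module Partner (X : Subset nE) (a b : Fin nV → Fin nV) (S : Subset nV) (separated : Separated a b S)
    (toA : ∀ w → S w ≡ true → ∃[ e ] X e ≡ true × Joins e w (a w))
    (toB : ∀ w → S w ≡ true → ∃[ e ] X e ≡ false × Joins e w (b w)) where

    P : Subset nE
    P e = anyFin (λ w → S w ∧ (joinsᵇ e w (a w) ∨ joinsᵇ e w (b w)))

    P-member : ∀ {e} → P e ≡ true → ∃[ w ] S w ≡ true × (Joins e w (a w) ⊎ Joins e w (b w))
    P-member {e} p with anyFin⁻ _ p
    ... | w , q with ∨-true⁻ (∧-true⁻ʳ {S w} q)
    ...   | inj₁ r = w , ∧-true⁻ˡ q , inj₁ ((λ w≡aw → proj₁ (separated w w (∧-true⁻ˡ q) (∧-true⁻ˡ q)) (sym w≡aw)) ,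
                                           ∧-true⁻ˡ r , ∧-true⁻ʳ {incident G w e} r)
    ...   | inj₂ r = w , ∧-true⁻ˡ q , inj₂ ((λ w≡bw → proj₁ (proj₂ (separated w w (∧-true⁻ˡ q) (∧-true⁻ˡ q))) (sym w≡bw)) ,
                                           ∧-true⁻ˡ r , ∧-true⁻ʳ {incident G w e} r)

    P-a : ∀ {w e} → S w ≡ true → Joins e w (a w) → P e ≡ true
    P-a {w} Sw (_ , w∈e , aw∈e) = anyFin⁺ _ w (∧-true⁺ Sw (∨-true⁺ˡ (∧-true⁺ w∈e aw∈e)))

    P-b : ∀ {w e} → S w ≡ true → Joins e w (b w) → P e ≡ true
    P-b {w} Sw (_ , w∈e , bw∈e) = anyFin⁺ _ w (∧-true⁺ Sw (∨-true⁺ʳ {joinsᵇ _ w (a w)} (∧-true⁺ w∈e bw∈e)))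

    a-edge-in-X : ∀ {w e} → S w ≡ true → Joins e w (a w) → X e ≡ true
    a-edge-in-X {w} Sw e∼ = let f , Xf , f∼ = toA w Sw in subst (λ g → X g ≡ true) (joins-unique f∼ e∼) Xf

    a-b-meet : ∀ {w w′ e f x} → S w ≡ true → S w′ ≡ true → Joins e w (a w) → Joins f w′ (b w′) →
      incident G x e ≡ true → incident G x f ≡ true → w ≡ w′
    a-b-meet {w} {w′} Sw Sw′ e∼ f∼ x∈e x∈f with joins-incident e∼ x∈e | joins-incident f∼ x∈f
    ... | inj₁ x≡w  | inj₁ x≡w′  = trans (sym x≡w) x≡w′
    ... | inj₁ x≡w  | inj₂ x≡bw′ = ⊥-elim (proj₁ (proj₂ (separated w′ w Sw′ Sw)) (trans (sym x≡bw′) x≡w))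
    ... | inj₂ x≡aw | inj₁ x≡w′  = ⊥-elim (proj₁ (separated w w′ Sw Sw′) (trans (sym x≡aw) x≡w′))
    ... | inj₂ x≡aw | inj₂ x≡bw′ = ⊥-elim (proj₂ (proj₂ (separated w w′ Sw Sw′)) (trans (sym x≡aw) x≡bw′))

    unique-partner : ∀ {w e} → S w ≡ true → Joins e w (a w) →
      countFin (λ u → P u ∧ crossAdj (lineGraph G) X e u) ≡ 1
    unique-partner {w} {e} Sw e∼ = trans (countFin-cong partner) (countFin-eqb c)
      where
      c   = proj₁ (toB w Sw)
      Xc  = proj₁ (proj₂ (toB w Sw))
      c∼  = proj₂ (proj₂ (toB w Sw))
      Xe  = a-edge-in-X Sw e∼
      partner : ∀ u → (P u ∧ crossAdj (lineGraph G) X e u) ≡ eqb c u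
      partner u = Bool-ext to from
        where
        to : (P u ∧ crossAdj (lineGraph G) X e u) ≡ true → eqb c u ≡ true
        to p with P-member (∧-true⁻ˡ p) | crossAdj⁻ {X} (∧-true⁻ʳ {P u} p)
        ... | w′ , Sw′ , inj₁ u∼ | _ , crossing with () ← trans (sym crossing) (cong₂ _xor_ Xe (a-edge-in-X Sw′ u∼))
        ... | w′ , Sw′ , inj₂ u∼ | (x , x∈e , x∈u) , _ =
          ≡⇒eqb (joins-unique c∼ (subst (λ z → Joins u z (b z)) (sym (a-b-meet Sw Sw′ e∼ u∼ x∈e x∈u)) u∼))
        from : eqb c u ≡ true → (P u ∧ crossAdj (lineGraph G) X e u) ≡ true
        from q = subst (λ z → (P z ∧ crossAdj (lineGraph G) X e z) ≡ true) (eqb⇒≡ q)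
          (∧-true⁺ (P-b Sw c∼) (crossAdj⁺ {X} (λ e≡c → true≢false (trans (sym Xe) (trans (cong X e≡c) Xc)))
                                  (proj₁ (proj₂ e∼)) (proj₁ (proj₂ c∼)) (cong₂ _xor_ Xe Xc)))

  module CutMatching (X : Subset nE) (a b : Fin nV → Fin nV) (S : Subset nV) (separated : Separated a b S)
    (toA : ∀ w → S w ≡ true → ∃[ e ] X e ≡ true × Joins e w (a w))
    (toB : ∀ w → S w ≡ true → ∃[ e ] X e ≡ false × Joins e w (b w)) where

    open Partner X a b S separated toA toB public

    separated-mirror : Separated b a S
    separated-mirror y z Sy Sz =
      proj₁ (proj₂ (separated y z Sy Sz)) , proj₁ (separated y z Sy Sz) ,
      λ by≡az → proj₂ (proj₂ (separated z y Sz Sy)) (sym by≡az)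

    toA-mirror : ∀ w → S w ≡ true → ∃[ e ] not (X e) ≡ true × Joins e w (b w)
    toA-mirror w Sw = proj₁ (toB w Sw) , cong not (proj₁ (proj₂ (toB w Sw))) , proj₂ (proj₂ (toB w Sw))

    toB-mirror : ∀ w → S w ≡ true → ∃[ e ] not (X e) ≡ false × Joins e w (a w)
    toB-mirror w Sw = proj₁ (toA w Sw) , cong not (proj₁ (proj₂ (toA w Sw))) , proj₂ (proj₂ (toA w Sw))

    -- Seen from the complementary cut, the b-edges are the a-edges.
    private
      module Mirror = Partner (λ e → not (X e)) b a S separated-mirror toA-mirror toB-mirror

    not-xor-not : ∀ x y → (not x xor not y) ≡ (x xor y)
    not-xor-not true  y = refl
    not-xor-not false y = not-involutive y

    induced : isInducedMatchingSet (lineGraph G) X P ≡ true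
    induced = allFin⁺ _ at
      where
      at : ∀ e → (not (P e) ∨ (countFin (λ u → P u ∧ crossAdj (lineGraph G) X e u) ≡ᵇ 1)) ≡ true
      at e with P e in Pe
      ... | false = refl
      ... | true with P-member Pe
      ...   | w , Sw , inj₁ e∼ = cong (_≡ᵇ 1) (unique-partner Sw e∼)
      ...   | w , Sw , inj₂ e∼ = cong (_≡ᵇ 1) (trans (countFin-cong mirrored) (Mirror.unique-partner Sw e∼))
        where
        mirrored : ∀ u → (P u ∧ crossAdj (lineGraph G) X e u) ≡ (Mirror.P u ∧ crossAdj (lineGraph G) (λ f → not (X f)) e u)
        mirrored u = cong₂ _∧_ (anyFin-cong (λ w → cong (S w ∧_) (∨-comm (joinsᵇ u w (a w)) _)))
                               (cong (lineAdj G e u ∧_) (sym (not-xor-not (X e) (X u))))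

    |S|≤|P∩X| : countFin S ≤ countFin (λ e → P e ∧ X e)
    |S|≤|P∩X| = countFin-inj S (λ e → P e ∧ X e) (λ w Sw → proj₁ (toA w Sw))
      (λ w Sw → let _ , Xe , e∼ = toA w Sw in ∧-true⁺ (P-a Sw e∼) Xe) injective
      where
      injective : ∀ w w′ Sw Sw′ → proj₁ (toA w Sw) ≡ proj₁ (toA w′ Sw′) → w ≡ w′
      injective w w′ Sw Sw′ same with joins-incident (proj₂ (proj₂ (toA w Sw)))
                                        (subst (λ e → incident G w′ e ≡ true) (sym same) (proj₁ (proj₂ (proj₂ (proj₂ (toA w′ Sw′))))))
      ... | inj₁ w′≡w  = sym w′≡w
      ... | inj₂ w′≡aw = ⊥-elim (proj₁ (separated w w′ Sw Sw′) (sym w′≡aw))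

  midSize≤24*cutmim : ∀ X → midSize G X ≤ 24 * cutmim (lineGraph G) X
  midSize≤24*cutmim X = begin
    midSize G X                           ≤⟨ |Mid|≤24|S| ⟩
    24 * countFin S                       ≤⟨ *-monoʳ-≤ 24 |S|≤|P∩X| ⟩
    24 * countFin (λ e → P e ∧ X e)       ≤⟨ *-monoʳ-≤ 24 (cutmim-≥ (lineGraph G) X P induced) ⟩
    24 * cutmim (lineGraph G) X           ∎
    where
    open ≤-Reasoning
    Mid : Subset nV
    Mid v = anyFin (λ e → X e ∧ incident G v e) ∧ anyFin (λ e → not (X e) ∧ incident G v e)
    a b : Fin nV → Fin nV
    a = neighbourVia X
    b = neighbourVia (λ e → not (X e))
    toA : ∀ v → Mid v ≡ true → ∃[ e ] X e ≡ true × Joins e v (a v)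
    toA v m = neighbourVia-spec X v (∧-true⁻ˡ m)
    toB : ∀ v → Mid v ≡ true → ∃[ e ] X e ≡ false × Joins e v (b v)
    toB v m = let e , Xe , e∼ = neighbourVia-spec (λ e → not (X e)) v (∧-true⁻ʳ {anyFin (λ e → X e ∧ incident G v e)} m)
              in e , not-true⁻ Xe , e∼
    distinct : ∀ v → Mid v ≡ true → a v ≢ v × b v ≢ v × a v ≢ b v
    distinct v m =
      let e , Xe , e∼ = toA v m
          f , Xf , f∼ = toB v m
      in (λ av≡v → proj₁ e∼ (sym av≡v)) , (λ bv≡v → proj₁ f∼ (sym bv≡v)) ,
         (λ av≡bv → true≢false (trans (sym Xe) (trans (cong X (joins-unique e∼ (subst (Joins f v) (sym av≡bv) f∼))) Xf)))
    separated-subset = large-separated-subset Mid a b distinct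
    S = proj₁ separated-subset
    S⊆Mid = proj₁ (proj₂ separated-subset)
    |Mid|≤24|S| = proj₂ (proj₂ (proj₂ separated-subset))
    open CutMatching X a b S (proj₁ (proj₂ (proj₂ separated-subset)))
      (λ w Sw → toA w (S⊆Mid w Sw)) (λ w Sw → toB w (S⊆Mid w Sw))

IsFBranchWidth-≤-* : ∀ {N f g w w′} (k : ℕ) → (∀ X → f X ≤ k * g X) →
  IsFBranchWidth N f w → IsFBranchWidth N g w′ → w ≤ k * w′
IsFBranchWidth-≤-* {N} k f≤kg width width′ with 2 ≤? N
... | yes _ =
  let D , narrow = proj₁ width′
      x , y , xy , A , side , w≤fA = proj₂ width D
  in ≤-trans w≤fA (≤-trans (f≤kg A) (*-monoʳ-≤ k (narrow x y xy A side)))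
... | no _ = subst₂ (λ u v → u ≤ k * v) (sym width) (sym width′) (f≤kg (λ _ → false))

25n∸1≤24m⇒n≤m : ∀ n m → 1 ≤ n → 25 * n ∸ 1 ≤ 24 * m → n ≤ m
25n∸1≤24m⇒n≤m (suc n) m _ h with suc n ≤? m
... | yes n<m = n<m
... | no n≮m  = ⊥-elim (<⇒≱ (begin-strict
  24 * m              ≤⟨ *-monoʳ-≤ 24 (≤-pred (≰⇒> n≮m)) ⟩
  24 * n              ≤⟨ *-monoˡ-≤ n (n≤1+n 24) ⟩
  25 * n              <⟨ m<n+m (25 * n) {24} (s≤s z≤n) ⟩
  24 + 25 * n         ≡⟨ sym (cong (_∸ 1) (*-suc 25 n)) ⟩
  25 * suc n ∸ 1      ∎) h)
  where open ≤-Reasoning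

proposition4p6 : (n : ℕ) → 1 ≤ n → (G : SimpleGraph) → (b m : ℕ) →
    IsBranchWidth G b → IsMimWidth (lineGraph G) m →
    25 * n ∸ 1 ≤ b → n ≤ m
proposition4p6 n 1≤n G b m bw mimw 25n∸1≤b =
  25n∸1≤24m⇒n≤m n m 1≤n (≤-trans 25n∸1≤b (IsFBranchWidth-≤-* 24 (midSize≤24*cutmim G) bw mimw))
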